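{- Let $D=(V,A)$ be a digraph and $\mathcal{L}\subseteq 2^V$ a laminar family. If $f_{D,\mathcal{L}}(Z)=0$ for some non-empty $Z\subseteq V$, then there is no $\mathcal{L}$-tight arborescence in $D$ whose root lies outside $Z$.
   Context: A (spanning) arborescence of $D$ is a set $B\subseteq A$ which is a spanning tree in the undirected sense and in which every node has in-degree at most one; the node of in-degree $0$ is its root. $B$ is $\mathcal{L}$-tight if $|\delta^{in}_B(F)|\le 1$ for all $F\in\mathcal{L}$ and $|\delta^{in}_B(F)|=0$ for all $F\in\mathcal{L}$ containing the root of $B$. For $Z\subseteq V$, $\mathcal{L}_Z=\{F\in\mathcal{L}: F\cap Z\ne\emptyset\}$, $M_{D,\mathcal{L}}(Z)=\delta^{in}_D(Z)\setminus\bigcup_{F\in\mathcal{L}_Z}\delta^{out}_D(F)$ and $f_{D,\mathcal{L}}(Z)=|M_{D,\mathcal{L}}(Z)|$. -}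

module Defs where

open import Data.Nat using (ℕ; _≤_)
open import Data.Bool using (Bool; true; false; _∧_; not)
open import Data.Fin using (Fin)
open import Data.Fin.Subset using (Subset; _∈_; _∉_; _⊆_; _∩_; _∪_; ∁; ⋃; ∣_∣; Nonempty; Empty; ⁅_⁆)
open import Data.Fin.Subset.Properties using (nonempty?)
open import Data.Vec using (lookup; tabulate)
open import Data.List using (List; filter)
open import Data.List.Membership.Propositional renaming (_∈_ to _∈ₗ_)
open import Data.Sum using (_⊎_)
open import Data.Product using (_×_)
open import Relation.Nullary using (¬_)
open import Relation.Binary.PropositionalEquality using (_≡_)

-- A digraph D = (V, A) with V = Fin n and A = Fin m (parallel arcs and loops allowed);
-- arc a goes from tail a to head a.
record Digraph (n m : ℕ) : Set where
  field
    tail : Fin m → Fin n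
    head : Fin m → Fin n
open Digraph public

Laminar : ∀ {n} → List (Subset n) → Set
Laminar L = ∀ {X Y} → X ∈ₗ L → Y ∈ₗ L → (X ⊆ Y) ⊎ (Y ⊆ X) ⊎ Empty (X ∩ Y)

module _ {n m : ℕ} (D : Digraph n m) where

  δin : Subset n → Subset m
  δin F = tabulate λ a → lookup F (head D a) ∧ not (lookup F (tail D a))

  δout : Subset n → Subset m
  δout F = tabulate λ a → lookup F (tail D a) ∧ not (lookup F (head D a))

  inArcs : Fin n → Subset m
  inArcs v = tabulate λ a → lookup ⁅ v ⁆ (head D a)

  indeg : Subset m → Fin n → ℕ
  indeg B v = ∣ B ∩ inArcs v ∣

  Lof : List (Subset n) → Subset n → List (Subset n)
  Lof L Z = filter (λ F → nonempty? (F ∩ Z)) L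

  M : List (Subset n) → Subset n → Subset m
  M L Z = δin Z ∩ ∁ (⋃ (Data.List.map δout (Lof L Z)))

  f : List (Subset n) → Subset n → ℕ
  f L Z = ∣ M L Z ∣

  data Conn (B : Subset m) : Fin n → Fin n → Set where
    here : ∀ {u} → Conn B u u
    fwd  : ∀ {u} a → a ∈ B → Conn B (head D a) u → Conn B (tail D a) u
    bwd  : ∀ {u} a → a ∈ B → Conn B (tail D a) u → Conn B (head D a) u

  -- B is acyclic (undirected): no arc of B has its ends connected in B - a
  -- (in particular no loops).
  Acyclic : Subset m → Set
  Acyclic B = ∀ a → a ∈ B → ¬ Conn (B ∩ ∁ ⁅ a ⁆) (tail D a) (head D a)

  SpanningTree : Subset m → Set
  SpanningTree B = (∀ u v → Conn B u v) × Acyclic B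

  IsArborescence : Subset m → Fin n → Set
  IsArborescence B r = SpanningTree B × (∀ v → indeg B v ≤ 1) × indeg B r ≡ 0

  Tight : List (Subset n) → Subset m → Fin n → Set
  Tight L B r = ∀ F → F ∈ₗ L →
    (∣ B ∩ δin F ∣ ≤ 1) × (r ∈ F → ∣ B ∩ δin F ∣ ≡ 0)

module Submission where

-- In an L-tight arborescence every node is reached from the root r, and every U ∈ L (as
-- well as V itself) is entered at exactly one node, from which the tree reaches all of U
-- without leaving U. Starting from an entry point x ∉ Z of such a U (initially U = V,
-- x = r), follow the tree inside U to a node of U ∩ Z. The first arc of this path that
-- enters Z lies in δin(Z), so by f(Z) = 0 it leaves some F ∈ L meeting Z; laminarity
-- forces F ⊊ U, and the segment of the path before that arc enters F at a node outside Z.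
-- This descent along strictly smaller sets cannot go on forever.

open import Defs
open import Data.Nat using (ℕ; _≤_; _<_; s≤s; z≤n)
open import Data.Nat.Properties using (<-≤-trans; >⇒≢)
open import Data.Bool using (Bool; true; false; _∧_; not)
open import Data.Fin using (Fin; _≟_)
open import Data.Fin.Subset
  using (Subset; _∈_; _∉_; _⊆_; _⊂_; _∩_; ⋃; ∣_∣; Nonempty; Empty; ⊤; _-_; ⁅_⁆)
open import Data.Fin.Subset.Properties
open import Data.Fin.Subset.Induction using (Acc; acc; ⊂-wellFounded)
open import Data.Vec using (lookup; tabulate)
open import Data.Vec.Properties using (lookup∘tabulate; []=⇒lookup; lookup⇒[]=)
open import Data.List using (List; []; _∷_; map)
open import Data.List.Membership.Propositional using () renaming (_∈_ to _∈ₗ_)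
open import Data.List.Membership.Propositional.Properties using (∈-map⁻; ∈-filter⁻)
open import Data.List.Relation.Unary.Any using (here; there)
open import Data.Sum using (_⊎_; inj₁; inj₂)
open import Data.Product using (_×_; ∃; ∃₂; _,_; proj₁; proj₂)
open import Data.Unit using () renaming (⊤ to Unit)
open import Function using (_∘_)
open import Relation.Nullary using (¬_; yes; no; contradiction)
open import Relation.Binary.PropositionalEquality using (_≡_; refl; sym; trans; cong; cong₂; subst)

private
  variable
    k : ℕ
    x y : Fin k
    p : Subset k

∉⇒lookup≡false : x ∉ p → lookup p x ≡ false
∉⇒lookup≡false {x = x} {p} x∉p with lookup p x in eq
... | true  = contradiction (lookup⇒[]= x p eq) x∉p
... | false = refl

∈-tabulate⁺ : {g : Fin k → Bool} → g x ≡ true → x ∈ tabulate g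
∈-tabulate⁺ {x = x} {g} gx = lookup⇒[]= x (tabulate g) (trans (lookup∘tabulate g x) gx)

∈-tabulate⁻ : {g : Fin k → Bool} → x ∈ tabulate g → g x ≡ true
∈-tabulate⁻ {x = x} {g} x∈ = trans (sym (lookup∘tabulate g x)) ([]=⇒lookup x∈)

∧-not≡true⁻ : ∀ {b c} → b ∧ not c ≡ true → b ≡ true × c ≡ false
∧-not≡true⁻ {true} {false} _ = refl , refl

x∈p⇒0<∣p∣ : x ∈ p → 0 < ∣ p ∣
x∈p⇒0<∣p∣ {x = x} {p} x∈p = subst (_≤ ∣ p ∣) (∣⁅x⁆∣≡1 x) (p⊆q⇒∣p∣≤∣q∣ ⁅x⁆⊆p)
  where
  ⁅x⁆⊆p : ⁅ x ⁆ ⊆ p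
  ⁅x⁆⊆p y∈ = subst (_∈ p) (sym (x∈⁅y⁆⇒x≡y x y∈)) x∈p

∣p∣≤1⇒x≡y : ∣ p ∣ ≤ 1 → x ∈ p → y ∈ p → x ≡ y
∣p∣≤1⇒x≡y {p = p} {x} {y} ∣p∣≤1 x∈p y∈p with x ≟ y
... | yes x≡y = x≡y
... | no x≢y with <-≤-trans (<-≤-trans (s≤s (x∈p⇒0<∣p∣ y∈p-x)) (x∈p⇒∣p-x∣<∣p∣ x∈p)) ∣p∣≤1
  where
  y∈p-x : y ∈ p - x
  y∈p-x = x∈p∧x≢y⇒x∈p-y y∈p (x≢y ∘ sym)
... | s≤s ()

x∈⋃⁻ : ∀ (ps : List (Subset k)) → x ∈ ⋃ ps → ∃ λ p → p ∈ₗ ps × x ∈ p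
x∈⋃⁻ []       x∈ = contradiction x∈ ∉⊥
x∈⋃⁻ (p ∷ ps) x∈ with x∈p∪q⁻ p (⋃ ps) x∈
... | inj₁ x∈p = p , here refl , x∈p
... | inj₂ x∈⋃ps with x∈⋃⁻ ps x∈⋃ps
...   | q , q∈ , x∈q = q , there q∈ , x∈q

NestedIn : List (Subset k) → Subset k → Set
NestedIn L U = ∀ {F} → F ∈ₗ L → F ⊆ U ⊎ U ⊆ F ⊎ Empty (F ∩ U)

⊤-nested : ∀ {L : List (Subset k)} → NestedIn L ⊤
⊤-nested _ = inj₁ ⊆⊤

laminar⇒nested : ∀ {L F} → Laminar L → F ∈ₗ L → NestedIn {k} L F
laminar⇒nested laminar F∈L G∈L = laminar G∈L F∈L

crossing⇒⊂ : ∀ {L F U} → NestedIn L U → F ∈ₗ L → x ∈ F → x ∈ U → y ∈ U → y ∉ F → F ⊂ U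
crossing⇒⊂ nested F∈L x∈F x∈U y∈U y∉F with nested F∈L
... | inj₁ F⊆U         = F⊆U , _ , y∈U , y∉F
... | inj₂ (inj₁ U⊆F)  = contradiction (U⊆F y∈U) y∉F
... | inj₂ (inj₂ F∩U≡∅) = contradiction (_ , x∈p∩q⁺ (x∈F , x∈U)) F∩U≡∅

-- δin and δout are both of this shape, with (s , t) = (head , tail) resp. (tail , head).
module _ {k l} {F : Subset k} {s t : Fin l → Fin k} {a : Fin l} where

  ∈-cut⁺ : s a ∈ F → t a ∉ F → a ∈ tabulate (λ b → lookup F (s b) ∧ not (lookup F (t b)))
  ∈-cut⁺ s∈ t∉ = ∈-tabulate⁺ (cong₂ (λ b c → b ∧ not c) ([]=⇒lookup s∈) (∉⇒lookup≡false t∉))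

  ∈-cut⁻ : a ∈ tabulate (λ b → lookup F (s b) ∧ not (lookup F (t b))) → s a ∈ F × t a ∉ F
  ∈-cut⁻ a∈ with ∧-not≡true⁻ (∈-tabulate⁻ a∈)
  ... | s∈ , t∉ = lookup⇒[]= _ F s∈ , λ t∈ → contradiction (trans (sym ([]=⇒lookup t∈)) t∉) λ ()

module _ {n m} (D : Digraph n m) where

  ∈inArcs⁺ : ∀ {a v} → head D a ≡ v → a ∈ inArcs D v
  ∈inArcs⁺ {a} refl = ∈-tabulate⁺ ([]=⇒lookup (x∈⁅x⁆ (head D a)))

  f≡0⇒δin-leaves-L_Z : ∀ {L Z a} → f D L Z ≡ 0 → a ∈ δin D Z →
    ∃ λ F → F ∈ₗ L × Nonempty (F ∩ Z) × tail D a ∈ F × head D a ∉ F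
  f≡0⇒δin-leaves-L_Z {L} {Z} {a} fZ≡0 a∈δinZ
    with a ∈? ⋃ (map (δout D) (Lof D L Z))
  ... | no a∉ = contradiction fZ≡0 (>⇒≢ (x∈p⇒0<∣p∣ (x∈p∩q⁺ (a∈δinZ , x∉p⇒x∈∁p a∉))))
  ... | yes a∈ with x∈⋃⁻ _ a∈
  ...   | _ , S∈ , a∈S with ∈-map⁻ (δout D) S∈
  ...     | F , F∈L_Z , refl with ∈-filter⁻ (λ F → nonempty? (F ∩ Z)) {xs = L} F∈L_Z
  ...       | F∈L , F∩Z≢∅ = F , F∈L , F∩Z≢∅ , ∈-cut⁻ a∈S

module Arborescence {n m} (D : Digraph n m) (B : Subset m) where

  data Path (P : Fin n → Set) : Fin n → Fin n → Set where
    nil  : ∀ {u} → P u → Path P u u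
    snoc : ∀ {u} a → a ∈ B → Path P u (tail D a) → P (head D a) → Path P u (head D a)

  atSource : ∀ {P u v} → Path P u v → P u
  atSource (nil pu)       = pu
  atSource (snoc _ _ p _) = atSource p

  atTarget : ∀ {P u v} → Path P u v → P v
  atTarget (nil pu)        = pu
  atTarget (snoc _ _ _ pv) = pv

  data FirstEntry (P : Fin n → Set) (X : Subset n) (u : Fin n) : Set where
    entry : ∀ a → a ∈ B → tail D a ∉ X → head D a ∈ X → P (head D a) →
            Path (λ y → P y × y ∉ X) u (tail D a) → FirstEntry P X u

  avoidOrEnter : ∀ {P u v} (X : Subset n) → Path P u v → u ∉ X →
    Path (λ y → P y × y ∉ X) u v ⊎ FirstEntry P X u
  avoidOrEnter X (nil pu) u∉ = inj₁ (nil (pu , u∉))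
  avoidOrEnter X (snoc a a∈B p ph) u∉ with avoidOrEnter X p u∉
  ... | inj₂ e = inj₂ e
  ... | inj₁ q with head D a ∈? X
  ...   | yes h∈ = inj₂ (entry a a∈B (proj₂ (atTarget q)) h∈ ph q)
  ...   | no h∉  = inj₁ (snoc a a∈B q (ph , h∉))

  firstEntry : ∀ {P u v} (X : Subset n) → Path P u v → u ∉ X → v ∈ X → FirstEntry P X u
  firstEntry X p u∉ v∈ with avoidOrEnter X p u∉
  ... | inj₁ q = contradiction v∈ (proj₂ (atTarget q))
  ... | inj₂ e = e

  module Rooted (r : Fin n) where

    Reach : Fin n → Set
    Reach = Path (λ _ → Unit) r

    data EntersAt (U : Subset n) : Fin n → Set where
      root : r ∈ U → EntersAt U r
      arc  : ∀ b → b ∈ B → tail D b ∉ U → head D b ∈ U → EntersAt U (head D b)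

    restrict : ∀ {X U u} → X ⊆ U → EntersAt U u → u ∈ X → EntersAt X u
    restrict X⊆U (root _)            r∈X = root r∈X
    restrict X⊆U (arc b b∈B t∉U _) h∈X = arc b b∈B (t∉U ∘ X⊆U) h∈X

    suffixIn : ∀ {P X U u v} → X ⊆ U → EntersAt U u → Path P u v → v ∈ X →
      ∃ λ s → EntersAt X s × P s × Path (_∈ X) s v
    suffixIn X⊆U e (nil pu) u∈X = _ , restrict X⊆U e u∈X , pu , nil u∈X
    suffixIn {X = X} X⊆U e (snoc a a∈B p ph) h∈X with tail D a ∈? X
    ... | no t∉  = _ , arc a a∈B t∉ h∈X , ph , nil h∈X
    ... | yes t∈ with suffixIn X⊆U e p t∈
    ...   | s , es , ps , q = s , es , ps , snoc a a∈B q h∈X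

    TightAt : Subset n → Set
    TightAt U = (∣ B ∩ δin D U ∣ ≤ 1) × (r ∈ U → ∣ B ∩ δin D U ∣ ≡ 0)

    EntersAt-unique : ∀ {U x y} → TightAt U → EntersAt U x → EntersAt U y → x ≡ y
    EntersAt-unique _ (root _) (root _) = refl
    EntersAt-unique (_ , noneIn) (root r∈U) (arc b b∈B t∉ h∈) =
      contradiction (noneIn r∈U) (>⇒≢ (x∈p⇒0<∣p∣ (x∈p∩q⁺ (b∈B , ∈-cut⁺ h∈ t∉))))
    EntersAt-unique (_ , noneIn) (arc b b∈B t∉ h∈) (root r∈U) =
      contradiction (noneIn r∈U) (>⇒≢ (x∈p⇒0<∣p∣ (x∈p∩q⁺ (b∈B , ∈-cut⁺ h∈ t∉))))
    EntersAt-unique (atMostOne , _) (arc b b∈B tb∉ hb∈) (arc c c∈B tc∉ hc∈) =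
      cong (head D) (∣p∣≤1⇒x≡y atMostOne (x∈p∩q⁺ (b∈B , ∈-cut⁺ hb∈ tb∉)) (x∈p∩q⁺ (c∈B , ∈-cut⁺ hc∈ tc∉)))

    module _ (indeg≤1 : ∀ v → indeg D B v ≤ 1) (indeg-r≡0 : indeg D B r ≡ 0) where

      reach-tail : ∀ {a v} → a ∈ B → Reach v → v ≡ head D a → Reach (tail D a)
      reach-tail a∈B (nil _) r≡h =
        contradiction indeg-r≡0 (>⇒≢ (x∈p⇒0<∣p∣ (x∈p∩q⁺ (a∈B , ∈inArcs⁺ D (sym r≡h)))))
      reach-tail {a} a∈B (snoc b b∈B p _) hb≡ha
        with ∣p∣≤1⇒x≡y (indeg≤1 (head D a)) (x∈p∩q⁺ (b∈B , ∈inArcs⁺ D hb≡ha)) (x∈p∩q⁺ (a∈B , ∈inArcs⁺ D refl))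
      ... | refl = p

      Reach-resp-Conn : ∀ {u v} → Reach u → Conn D B u v → Reach v
      Reach-resp-Conn p here            = p
      Reach-resp-Conn p (fwd a a∈B c) = Reach-resp-Conn (snoc a a∈B p _) c
      Reach-resp-Conn p (bwd a a∈B c) = Reach-resp-Conn (reach-tail a∈B p refl) c

    ⊤-tight : TightAt ⊤
    ⊤-tight = subst (_≤ 1) (sym ∣B∩δin⊤∣≡0) z≤n , λ _ → ∣B∩δin⊤∣≡0
      where
      B∩δin⊤-empty : Empty (B ∩ δin D ⊤)
      B∩δin⊤-empty (a , a∈) = proj₂ (∈-cut⁻ {s = head D} {t = tail D} (proj₂ (x∈p∩q⁻ B (δin D ⊤) a∈))) ∈⊤

      ∣B∩δin⊤∣≡0 : ∣ B ∩ δin D ⊤ ∣ ≡ 0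
      ∣B∩δin⊤∣≡0 = trans (cong ∣_∣ (Empty-unique B∩δin⊤-empty)) (∣⊥∣≡0 m)

    module _ (reach : ∀ v → Reach v) where

      pathWithin : ∀ {U x w} → TightAt U → EntersAt U x → w ∈ U → Path (_∈ U) x w
      pathWithin {w = w} tight e w∈U with suffixIn ⊆⊤ (root ∈⊤) (reach w) w∈U
      ... | s , es , _ , q rewrite EntersAt-unique tight e es = q

      module _ {L} (laminar : Laminar L) (tight : Tight D L B r) {Z} (fZ≡0 : f D L Z ≡ 0) where

        descend : ∀ {U x} → TightAt U → NestedIn L U → EntersAt U x → x ∉ Z → Nonempty (U ∩ Z) →
          ∃₂ λ F y → F ∈ₗ L × F ⊂ U × EntersAt F y × y ∉ Z × Nonempty (F ∩ Z)
        descend {U} tightU nestedU e x∉Z (w , w∈U∩Z) with x∈p∩q⁻ U Z w∈U∩Z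
        ... | w∈U , w∈Z with firstEntry Z (pathWithin tightU e w∈U) x∉Z w∈Z
        ... | entry a _ ta∉Z ha∈Z ha∈U q with f≡0⇒δin-leaves-L_Z D fZ≡0 (∈-cut⁺ ha∈Z ta∉Z)
        ... | F , F∈L , F∩Z≢∅ , ta∈F , ha∉F
          with crossing⇒⊂ nestedU F∈L ta∈F (proj₁ (atTarget q)) ha∈U ha∉F
        ... | F⊂U with suffixIn (proj₁ F⊂U) e q ta∈F
        ... | y , eF , (_ , y∉Z) , _ = F , y , F∈L , F⊂U , eF , y∉Z , F∩Z≢∅

        entry∉Z⇒Empty-U∩Z : ∀ {U x} → Acc _⊂_ U → TightAt U → NestedIn L U → EntersAt U x → x ∉ Z →
          Empty (U ∩ Z)
        entry∉Z⇒Empty-U∩Z (acc smaller) tightU nestedU e x∉Z U∩Z≢∅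
          with descend tightU nestedU e x∉Z U∩Z≢∅
        ... | F , _ , F∈L , F⊂U , eF , y∉Z , F∩Z≢∅ =
          entry∉Z⇒Empty-U∩Z (smaller F⊂U) (tight F F∈L) (laminar⇒nested laminar F∈L) eF y∉Z F∩Z≢∅

lemma3 : ∀ {n m} (D : Digraph n m) (L : List (Subset n)) → Laminar L →
    (Z : Subset n) → Nonempty Z → f D L Z ≡ 0 →
    ¬ (∃₂ λ (B : Subset m) (r : Fin n) →
         IsArborescence D B r × Tight D L B r × r ∉ Z)
lemma3 D L laminar Z (z , z∈Z) fZ≡0 (B , r , ((conn , _) , indeg≤1 , indeg-r≡0) , tight , r∉Z) =
  entry∉Z⇒Empty-U∩Z reach laminar tight fZ≡0 (⊂-wellFounded ⊤) ⊤-tight ⊤-nested (root ∈⊤) r∉Z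
    (z , x∈p∩q⁺ (∈⊤ , z∈Z))
  where
  open Arborescence D B
  open Rooted r

  reach : ∀ v → Reach v
  reach v = Reach-resp-Conn indeg≤1 indeg-r≡0 (nil _) (conn r v)
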